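{- Work in intuitionistic logic over the theory $\mathrm{IKP}-\Delta_0\text{ Bounding}$ (defined in the context). Over this theory the following three axiom schemes are equivalent: (1) $\Pi$ Persistence: for every $\Pi$ formula $\phi$, $\forall A\,\phi^{(A)}\rightarrow\phi$; (2) $\Pi$ Uniformity: for every $\Pi$ formula $\phi(x,y)$ (possibly with further parameters), $\forall B\,\exists x\in A\,\forall y\in B\,\phi(x,y)\rightarrow\exists x\in A\,\forall y\,\phi(x,y)$; (3) $\Delta_0$ Uniformity: for every $\Delta_0$ formula $\phi(x,y)$ (possibly with further parameters), $\forall B\,\exists x\in A\,\forall y\in B\,\phi(x,y)\rightarrow\exists x\in A\,\forall y\,\phi(x,y)$.
   Context: IKP (intuitionistic Kripke–Platek set theory) is the theory in intuitionistic first-order logic with $\in$ and $=$ consisting of: Empty Set, Pairing, Union, Extensionality, $\in$-Induction (the schema $\forall x(\forall y\in x\,\phi(y)\rightarrow\phi(x))\rightarrow\forall x\,\phi(x)$ for all formulas $\phi$), $\Delta_0$ Separation, $\Delta_0$ Bounding (for $\Delta_0$ $\phi$: $\forall x\in A\,\exists y\,\phi(x,y)\rightarrow\exists B\,\forall x\in A\,\exists y\in B\,\phi(x,y)$), and Infinity in the form $\exists x\,[0\in x\wedge\forall y\in x\,\exists z\in x\,(z=y\cup\{y\})\wedge\forall y\in x\,(y=0\vee\exists z\in x\,y=z\cup\{z\})]$. $\mathrm{IKP}-\Delta_0\text{ Bounding}$ is IKP without the $\Delta_0$ Bounding schema. $\Delta_0$ formulas are those in which all quantifiers are bounded ($\exists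 u\in v$, $\forall u\in v$). The $\Pi$ formulas are the smallest class containing the $\Delta_0$ formulas and closed under $\wedge$, $\vee$, bounded quantifiers $\exists u\in v$, $\forall u\in v$, and unbounded universal quantification $\forall u$. For a formula $\phi$ and a set $A$, $\phi^{(A)}$ denotes the result of bounding every unbounded quantifier of $\phi$ by $A$ (i.e., $\forall u$ becomes $\forall u\in A$, $\exists u$ becomes $\exists u\in A$). -}

module Defs where

open import Data.Nat using (ℕ; zero; suc)
open import Data.Fin using (Fin; zero; suc)
open import Data.List using (List; []; _∷_; map)
open import Data.Product using (_×_)
open import Data.Sum using (_⊎_)
import Data.List.Membership.Propositional as LM

-- Syntax of first-order set theory (language {∈, =}), well-scoped
-- de Bruijn: Fm n = formulas with free variables among Fin n.
-- Bounded quantifiers are primitive:  ∀∈ v φ  is  ∀u∈v φ(u),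
-- ∃∈ v φ is ∃u∈v φ(u)  (u is the new variable zero of the body).

infix  8 _∈'_ _≐_
infixr 6 _∧'_
infixr 5 _∨'_
infixr 4 _⇒'_ _⇔'_

data Fm (n : ℕ) : Set where
  _∈'_ _≐_        : Fin n → Fin n → Fm n
  ⊥'              : Fm n
  _∧'_ _∨'_ _⇒'_  : Fm n → Fm n → Fm n
  ∀' ∃'           : Fm (suc n) → Fm n
  ∀∈ ∃∈           : Fin n → Fm (suc n) → Fm n

_⇔'_ : ∀ {n} → Fm n → Fm n → Fm n
φ ⇔' ψ = (φ ⇒' ψ) ∧' (ψ ⇒' φ)

v0 : ∀ {n} → Fin (suc n)
v0 = zero
v1 : ∀ {n} → Fin (suc (suc n))
v1 = suc zero
v2 : ∀ {n} → Fin (suc (suc (suc n)))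
v2 = suc (suc zero)

-- renaming (terms are variables, so this is also substitution)
ext : ∀ {n m} → (Fin n → Fin m) → Fin (suc n) → Fin (suc m)
ext ρ zero    = zero
ext ρ (suc i) = suc (ρ i)

ren : ∀ {n m} → (Fin n → Fin m) → Fm n → Fm m
ren ρ (x ∈' y) = ρ x ∈' ρ y
ren ρ (x ≐ y)  = ρ x ≐ ρ y
ren ρ ⊥'       = ⊥'
ren ρ (φ ∧' ψ) = ren ρ φ ∧' ren ρ ψ
ren ρ (φ ∨' ψ) = ren ρ φ ∨' ren ρ ψ
ren ρ (φ ⇒' ψ) = ren ρ φ ⇒' ren ρ ψ
ren ρ (∀' φ)   = ∀' (ren (ext ρ) φ)
ren ρ (∃' φ)   = ∃' (ren (ext ρ) φ)
ren ρ (∀∈ v φ) = ∀∈ (ρ v) (ren (ext ρ) φ)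
ren ρ (∃∈ v φ) = ∃∈ (ρ v) (ren (ext ρ) φ)

wk : ∀ {n} → Fm n → Fm (suc n)
wk = ren suc

sub₁ : ∀ {n} → Fin n → Fin (suc n) → Fin n
sub₁ t zero    = t
sub₁ t (suc i) = i

_[_] : ∀ {n} → Fm (suc n) → Fin n → Fm n
φ [ t ] = ren (sub₁ t) φ

emb : ∀ {n} → Fm 0 → Fm n
emb = ren (λ ())

data Δ₀ {n : ℕ} : Fm n → Set where
  mem  : ∀ x y → Δ₀ (x ∈' y)
  eq   : ∀ x y → Δ₀ (x ≐ y)
  bot  : Δ₀ ⊥'
  and  : ∀ {φ ψ} → Δ₀ φ → Δ₀ ψ → Δ₀ (φ ∧' ψ)
  or   : ∀ {φ ψ} → Δ₀ φ → Δ₀ ψ → Δ₀ (φ ∨' ψ)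
  imp  : ∀ {φ ψ} → Δ₀ φ → Δ₀ ψ → Δ₀ (φ ⇒' ψ)
  ball : ∀ v {φ} → Δ₀ φ → Δ₀ (∀∈ v φ)
  bex  : ∀ v {φ} → Δ₀ φ → Δ₀ (∃∈ v φ)

data IsΠ {n : ℕ} : Fm n → Set where
  δ₀   : ∀ {φ} → Δ₀ φ → IsΠ φ
  and  : ∀ {φ ψ} → IsΠ φ → IsΠ ψ → IsΠ (φ ∧' ψ)
  or   : ∀ {φ ψ} → IsΠ φ → IsΠ ψ → IsΠ (φ ∨' ψ)
  ball : ∀ v {φ} → IsΠ φ → IsΠ (∀∈ v φ)
  bex  : ∀ v {φ} → IsΠ φ → IsΠ (∃∈ v φ)
  all  : ∀ {φ} → IsΠ φ → IsΠ (∀' φ)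

rel : ∀ {n} → Fin n → Fm n → Fm n
rel A (x ∈' y) = x ∈' y
rel A (x ≐ y)  = x ≐ y
rel A ⊥'       = ⊥'
rel A (φ ∧' ψ) = rel A φ ∧' rel A ψ
rel A (φ ∨' ψ) = rel A φ ∨' rel A ψ
rel A (φ ⇒' ψ) = rel A φ ⇒' rel A ψ
rel A (∀' φ)   = ∀∈ A (rel (suc A) φ)
rel A (∃' φ)   = ∃∈ A (rel (suc A) φ)
rel A (∀∈ v φ) = ∀∈ v (rel (suc A) φ)
rel A (∃∈ v φ) = ∃∈ v (rel (suc A) φ)

Theory : Set₁
Theory = ∀ {n} → Fm n → Set

_∪ₜ_ : Theory → Theory → Theory
(T ∪ₜ S) φ = T φ ⊎ S φ

infix 2 _⨾_⊢_

data _⨾_⊢_ (T : Theory) : ∀ {n} → List (Fm n) → Fm n → Set where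
  hyp  : ∀ {n} {Γ : List (Fm n)} {φ} → φ LM.∈ Γ → T ⨾ Γ ⊢ φ
  ax   : ∀ {n} {Γ : List (Fm n)} {φ} → T φ → T ⨾ Γ ⊢ φ
  ⊥E   : ∀ {n} {Γ : List (Fm n)} {φ} → T ⨾ Γ ⊢ ⊥' → T ⨾ Γ ⊢ φ
  ∧I   : ∀ {n} {Γ : List (Fm n)} {φ ψ} → T ⨾ Γ ⊢ φ → T ⨾ Γ ⊢ ψ → T ⨾ Γ ⊢ φ ∧' ψ
  ∧E₁  : ∀ {n} {Γ : List (Fm n)} {φ ψ} → T ⨾ Γ ⊢ φ ∧' ψ → T ⨾ Γ ⊢ φ
  ∧E₂  : ∀ {n} {Γ : List (Fm n)} {φ ψ} → T ⨾ Γ ⊢ φ ∧' ψ → T ⨾ Γ ⊢ ψ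
  ∨I₁  : ∀ {n} {Γ : List (Fm n)} {φ ψ} → T ⨾ Γ ⊢ φ → T ⨾ Γ ⊢ φ ∨' ψ
  ∨I₂  : ∀ {n} {Γ : List (Fm n)} {φ ψ} → T ⨾ Γ ⊢ ψ → T ⨾ Γ ⊢ φ ∨' ψ
  ∨E   : ∀ {n} {Γ : List (Fm n)} {φ ψ χ} → T ⨾ Γ ⊢ φ ∨' ψ →
         T ⨾ φ ∷ Γ ⊢ χ → T ⨾ ψ ∷ Γ ⊢ χ → T ⨾ Γ ⊢ χ
  ⇒I   : ∀ {n} {Γ : List (Fm n)} {φ ψ} → T ⨾ φ ∷ Γ ⊢ ψ → T ⨾ Γ ⊢ φ ⇒' ψ
  ⇒E   : ∀ {n} {Γ : List (Fm n)} {φ ψ} → T ⨾ Γ ⊢ φ ⇒' ψ → T ⨾ Γ ⊢ φ → T ⨾ Γ ⊢ ψ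
  ∀I   : ∀ {n} {Γ : List (Fm n)} {φ} → T ⨾ map wk Γ ⊢ φ → T ⨾ Γ ⊢ ∀' φ
  ∀E   : ∀ {n} {Γ : List (Fm n)} {φ} → T ⨾ Γ ⊢ ∀' φ → (t : Fin n) → T ⨾ Γ ⊢ φ [ t ]
  ∃I   : ∀ {n} {Γ : List (Fm n)} {φ} (t : Fin n) → T ⨾ Γ ⊢ φ [ t ] → T ⨾ Γ ⊢ ∃' φ
  ∃E   : ∀ {n} {Γ : List (Fm n)} {φ ψ} → T ⨾ Γ ⊢ ∃' φ →
         T ⨾ φ ∷ map wk Γ ⊢ wk ψ → T ⨾ Γ ⊢ ψ
  ∀∈I  : ∀ {n} {Γ : List (Fm n)} {v φ} →
         T ⨾ (v0 ∈' suc v) ∷ map wk Γ ⊢ φ → T ⨾ Γ ⊢ ∀∈ v φ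
  ∀∈E  : ∀ {n} {Γ : List (Fm n)} {v φ} → T ⨾ Γ ⊢ ∀∈ v φ →
         (t : Fin n) → T ⨾ Γ ⊢ t ∈' v → T ⨾ Γ ⊢ φ [ t ]
  ∃∈I  : ∀ {n} {Γ : List (Fm n)} {v φ} (t : Fin n) →
         T ⨾ Γ ⊢ t ∈' v → T ⨾ Γ ⊢ φ [ t ] → T ⨾ Γ ⊢ ∃∈ v φ
  ∃∈E  : ∀ {n} {Γ : List (Fm n)} {v φ ψ} → T ⨾ Γ ⊢ ∃∈ v φ →
         T ⨾ φ ∷ (v0 ∈' suc v) ∷ map wk Γ ⊢ wk ψ → T ⨾ Γ ⊢ ψ
  ≐refl  : ∀ {n} {Γ : List (Fm n)} (t : Fin n) → T ⨾ Γ ⊢ t ≐ t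
  ≐subst : ∀ {n} {Γ : List (Fm n)} {s t : Fin n} (φ : Fm (suc n)) →
           T ⨾ Γ ⊢ s ≐ t → T ⨾ Γ ⊢ φ [ s ] → T ⨾ Γ ⊢ φ [ t ]

-- T proves every instance of S (parameters read universally)
_⊩_ : Theory → Theory → Set
T ⊩ S = ∀ {n} {φ : Fm n} → S φ → T ⨾ [] ⊢ φ

EquivOver : Theory → Theory → Theory → Set
EquivOver T S₁ S₂ = ((T ∪ₜ S₁) ⊩ S₂) × ((T ∪ₜ S₂) ⊩ S₁)

isEmpty : ∀ {n} → Fin n → Fm n
isEmpty y = ∀∈ y ⊥'

-- z = y ∪ {y}
isSucc : ∀ {n} → Fin n → Fin n → Fm n
isSucc z y = ∀∈ z ((v0 ∈' suc y) ∨' (v0 ≐ suc y))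
          ∧' ∀∈ y (v0 ∈' suc z)
          ∧' (y ∈' z)

EmptySetAx : Fm 0
EmptySetAx = ∃' (∀∈ v0 ⊥')

PairingAx : Fm 0
PairingAx = ∀' (∀' (∃' ((v2 ∈' v0) ∧' (v1 ∈' v0))))

UnionAx : Fm 0
UnionAx = ∀' (∃' (∀∈ v1 (∀∈ v0 (v0 ∈' v2))))

ExtensionalityAx : Fm 0
ExtensionalityAx =
  ∀' (∀' ((∀∈ v1 (v0 ∈' v1) ∧' ∀∈ v0 (v0 ∈' v2)) ⇒' (v1 ≐ v0)))

InfinityAx : Fm 0
InfinityAx = ∃' ( ∃∈ v0 (isEmpty v0)
               ∧' ∀∈ v0 (∃∈ v1 (isSucc v0 v1))
               ∧' ∀∈ v0 (isEmpty v0 ∨' ∃∈ v1 (isSucc v1 v0)) )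

-- ∀x(∀y∈x φ(y) → φ(x)) → ∀x φ(x)   (φ : variable zero, params suc i)
∈-IndInst : ∀ {n} → Fm (suc n) → Fm n
∈-IndInst φ = ∀' (∀∈ v0 (ren (ext suc) φ) ⇒' φ) ⇒' ∀' φ

-- ∀a ∃b ∀x (x∈b ↔ x∈a ∧ φ(x))
SepInst : ∀ {n} → Fm (suc n) → Fm n
SepInst φ = ∀' (∃' (∀' ((v0 ∈' v1) ⇔'
              ((v0 ∈' v2) ∧' ren (ext (λ i → suc (suc i))) φ))))

data IKP⁻ : Theory where
  emptySet      : ∀ {n} → IKP⁻ {n} (emb EmptySetAx)
  pairing       : ∀ {n} → IKP⁻ {n} (emb PairingAx)
  union         : ∀ {n} → IKP⁻ {n} (emb UnionAx)
  extensionality : ∀ {n} → IKP⁻ {n} (emb ExtensionalityAx)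
  infinity      : ∀ {n} → IKP⁻ {n} (emb InfinityAx)
  ∈-induction   : ∀ {n} (φ : Fm (suc n)) → IKP⁻ (∈-IndInst φ)
  Δ₀-separation : ∀ {n} (φ : Fm (suc n)) → Δ₀ φ → IKP⁻ (SepInst φ)

data ΠPersistence : Theory where
  inst : ∀ {n} (φ : Fm n) → IsΠ φ → ΠPersistence (∀' (rel v0 (wk φ)) ⇒' φ)

-- φ(x,y) : Fm (2+n) with y = variable 0, x = variable 1, parameters 2+i;
-- A : Fin n is a parameter (a free variable, which may also occur in φ).
-- ∀B ∃x∈A ∀y∈B φ(x,y) → ∃x∈A ∀y φ(x,y)
UnifInst : ∀ {n} → Fin n → Fm (suc (suc n)) → Fm n
UnifInst A φ =
  ∀' (∃∈ (suc A) (∀∈ v1 (ren (ext (ext suc)) φ))) ⇒' ∃∈ A (∀' φ)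

data ΠUniformity : Theory where
  inst : ∀ {n} (A : Fin n) (φ : Fm (suc (suc n))) → IsΠ φ →
         ΠUniformity (UnifInst A φ)

data Δ₀Uniformity : Theory where
  inst : ∀ {n} (A : Fin n) (φ : Fm (suc (suc n))) → Δ₀ φ →
         Δ₀Uniformity (UnifInst A φ)

module Submission where

--  * Persistence ⇒ Π Uniformity.  Π formulas are downward absolute
--    (χ → χ^(B)), so the uniformity premise ∀B ∃x∈A ∀y∈B φ(x,y) yields
--    ∀B (∃x∈A ∀y φ(x,y))^(B); persistence for the Π formula ∃x∈A ∀y φ
--    gives the conclusion.
--  * Π Uniformity ⇒ Δ₀ Uniformity is immediate (Δ₀ ⊆ Π).
--  * Δ₀ Uniformity ⇒ Persistence, by induction on the Π formula χ, using
--    that χ^(D) → χ^(C) whenever C ⊆ D (antitonicity).  Each connective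
--    commutes with everyRel: for ∀u∈v by swapping quantifiers, for ∀u by
--    enlarging A to some C ⊇ A with u ∈ C, and for ∃u∈v resp. ∨ by
--    Δ₀ uniformity over v resp. over a set containing 0 and 1 (the index
--    records which disjunct holds).  In the last two cases, given B, the
--    instance at U = ⋃B is transported to all y ∈ B by antitonicity.

open import Defs
open import Data.Nat using (suc)
open import Data.Fin using (Fin; zero; suc)
open import Data.List using (List; []; _∷_; map)
open import Data.List.Membership.Propositional using (_∈_)
open import Data.List.Membership.Propositional.Properties using (∈-map⁺; ∈-map⁻)
open import Data.List.Relation.Unary.Any using (here; there)
open import Data.Sum using (inj₁; inj₂)
open import Data.Product using (_×_; _,_)
open import Function using (_∘_)
open import Relation.Binary.PropositionalEquality
  using (_≡_; _≗_; refl; sym; trans; cong; cong₂; subst)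

ext-cong : ∀ {n m} {ρ σ : Fin n → Fin m} → ρ ≗ σ → ext ρ ≗ ext σ
ext-cong h zero    = refl
ext-cong h (suc i) = cong suc (h i)

ren-cong : ∀ {n m} {ρ σ : Fin n → Fin m} → ρ ≗ σ → ∀ φ → ren ρ φ ≡ ren σ φ
ren-cong h (x ∈' y) = cong₂ _∈'_ (h x) (h y)
ren-cong h (x ≐ y)  = cong₂ _≐_ (h x) (h y)
ren-cong h ⊥'       = refl
ren-cong h (φ ∧' ψ) = cong₂ _∧'_ (ren-cong h φ) (ren-cong h ψ)
ren-cong h (φ ∨' ψ) = cong₂ _∨'_ (ren-cong h φ) (ren-cong h ψ)
ren-cong h (φ ⇒' ψ) = cong₂ _⇒'_ (ren-cong h φ) (ren-cong h ψ)
ren-cong h (∀' φ)   = cong ∀' (ren-cong (ext-cong h) φ)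
ren-cong h (∃' φ)   = cong ∃' (ren-cong (ext-cong h) φ)
ren-cong h (∀∈ v φ) = cong₂ ∀∈ (h v) (ren-cong (ext-cong h) φ)
ren-cong h (∃∈ v φ) = cong₂ ∃∈ (h v) (ren-cong (ext-cong h) φ)

ext-comp : ∀ {n m k} (σ : Fin m → Fin k) (ρ : Fin n → Fin m) →
           ext σ ∘ ext ρ ≗ ext (σ ∘ ρ)
ext-comp σ ρ zero    = refl
ext-comp σ ρ (suc i) = refl

ren-comp : ∀ {n m k} (σ : Fin m → Fin k) (ρ : Fin n → Fin m) φ →
           ren σ (ren ρ φ) ≡ ren (σ ∘ ρ) φ
ren-comp σ ρ (x ∈' y) = refl
ren-comp σ ρ (x ≐ y)  = refl
ren-comp σ ρ ⊥'       = refl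
ren-comp σ ρ (φ ∧' ψ) = cong₂ _∧'_ (ren-comp σ ρ φ) (ren-comp σ ρ ψ)
ren-comp σ ρ (φ ∨' ψ) = cong₂ _∨'_ (ren-comp σ ρ φ) (ren-comp σ ρ ψ)
ren-comp σ ρ (φ ⇒' ψ) = cong₂ _⇒'_ (ren-comp σ ρ φ) (ren-comp σ ρ ψ)
ren-comp σ ρ (∀' φ)   = cong ∀' (trans (ren-comp (ext σ) (ext ρ) φ) (ren-cong (ext-comp σ ρ) φ))
ren-comp σ ρ (∃' φ)   = cong ∃' (trans (ren-comp (ext σ) (ext ρ) φ) (ren-cong (ext-comp σ ρ) φ))
ren-comp σ ρ (∀∈ v φ) = cong (∀∈ _) (trans (ren-comp (ext σ) (ext ρ) φ) (ren-cong (ext-comp σ ρ) φ))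
ren-comp σ ρ (∃∈ v φ) = cong (∃∈ _) (trans (ren-comp (ext σ) (ext ρ) φ) (ren-cong (ext-comp σ ρ) φ))

ext-id : ∀ {n} {ρ : Fin n → Fin n} → (∀ i → ρ i ≡ i) → ∀ i → ext ρ i ≡ i
ext-id h zero    = refl
ext-id h (suc i) = cong suc (h i)

ren-id : ∀ {n} {ρ : Fin n → Fin n} → (∀ i → ρ i ≡ i) → ∀ φ → ren ρ φ ≡ φ
ren-id h (x ∈' y) = cong₂ _∈'_ (h x) (h y)
ren-id h (x ≐ y)  = cong₂ _≐_ (h x) (h y)
ren-id h ⊥'       = refl
ren-id h (φ ∧' ψ) = cong₂ _∧'_ (ren-id h φ) (ren-id h ψ)
ren-id h (φ ∨' ψ) = cong₂ _∨'_ (ren-id h φ) (ren-id h ψ)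
ren-id h (φ ⇒' ψ) = cong₂ _⇒'_ (ren-id h φ) (ren-id h ψ)
ren-id h (∀' φ)   = cong ∀' (ren-id (ext-id h) φ)
ren-id h (∃' φ)   = cong ∃' (ren-id (ext-id h) φ)
ren-id h (∀∈ v φ) = cong₂ ∀∈ (h v) (ren-id (ext-id h) φ)
ren-id h (∃∈ v φ) = cong₂ ∃∈ (h v) (ren-id (ext-id h) φ)

ren-fuse : ∀ {n m k} (σ : Fin m → Fin k) (ρ : Fin n → Fin m) (τ : Fin n → Fin k) →
           σ ∘ ρ ≗ τ → ∀ φ → ren σ (ren ρ φ) ≡ ren τ φ
ren-fuse σ ρ τ h φ = trans (ren-comp σ ρ φ) (ren-cong h φ)

inst-v0 : ∀ {n} (φ : Fm (suc n)) → (ren (ext suc) φ) [ v0 ] ≡ φ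
inst-v0 φ = trans (ren-comp (sub₁ v0) (ext suc) φ) (ren-id (λ { zero → refl ; (suc i) → refl }) φ)

wk-inst : ∀ {n} (φ : Fm n) (t : Fin n) → (wk φ) [ t ] ≡ φ
wk-inst φ t = trans (ren-comp (sub₁ t) suc φ) (ren-id (λ _ → refl) φ)

wk-ren : ∀ {n m} (ρ : Fin n → Fin m) φ → ren (ext ρ) (wk φ) ≡ wk (ren ρ φ)
wk-ren ρ φ = trans (ren-comp (ext ρ) suc φ) (sym (ren-comp suc ρ φ))

inst-ren : ∀ {n m} (ρ : Fin n → Fin m) t (φ : Fm (suc n)) →
           ren ρ (φ [ t ]) ≡ (ren (ext ρ) φ) [ ρ t ]
inst-ren ρ t φ = trans (ren-comp ρ (sub₁ t) φ)
  (trans (ren-cong (λ { zero → refl ; (suc i) → refl }) φ) (sym (ren-comp (sub₁ (ρ t)) (ext ρ) φ)))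

rel-ren : ∀ {n m} (ρ : Fin n → Fin m) A φ → ren ρ (rel A φ) ≡ rel (ρ A) (ren ρ φ)
rel-ren ρ A (x ∈' y) = refl
rel-ren ρ A (x ≐ y)  = refl
rel-ren ρ A ⊥'       = refl
rel-ren ρ A (φ ∧' ψ) = cong₂ _∧'_ (rel-ren ρ A φ) (rel-ren ρ A ψ)
rel-ren ρ A (φ ∨' ψ) = cong₂ _∨'_ (rel-ren ρ A φ) (rel-ren ρ A ψ)
rel-ren ρ A (φ ⇒' ψ) = cong₂ _⇒'_ (rel-ren ρ A φ) (rel-ren ρ A ψ)
rel-ren ρ A (∀' φ)   = cong (∀∈ _) (rel-ren (ext ρ) (suc A) φ)
rel-ren ρ A (∃' φ)   = cong (∃∈ _) (rel-ren (ext ρ) (suc A) φ)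
rel-ren ρ A (∀∈ v φ) = cong (∀∈ _) (rel-ren (ext ρ) (suc A) φ)
rel-ren ρ A (∃∈ v φ) = cong (∃∈ _) (rel-ren (ext ρ) (suc A) φ)

rel-ren-push : ∀ {n m k} {σ : Fin m → Fin k} {X : Fm m} {A : Fin m} {ρ : Fin n → Fin m} {χ : Fm n} →
               X ≡ rel A (ren ρ χ) → ren σ X ≡ rel (σ A) (ren (σ ∘ ρ) χ)
rel-ren-push {σ = σ} {A = A} {ρ = ρ} {χ = χ} refl =
  trans (rel-ren σ A (ren ρ χ)) (cong (rel (σ A)) (ren-comp σ ρ χ))

rel-ren-cong : ∀ {n m} {A : Fin m} {ρ ρ' : Fin n → Fin m} (χ : Fm n) →
               ρ ≗ ρ' → rel A (ren ρ χ) ≡ rel A (ren ρ' χ)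
rel-ren-cong χ h = cong (rel _) (ren-cong h χ)

everyRel : ∀ {n} → Fm n → Fm n
everyRel χ = ∀' (rel v0 (wk χ))

everyRel-ren : ∀ {n m} (ρ : Fin n → Fin m) χ → ren ρ (everyRel χ) ≡ everyRel (ren ρ χ)
everyRel-ren ρ χ = cong ∀' (trans (rel-ren (ext ρ) v0 (wk χ)) (cong (rel v0) (wk-ren ρ χ)))

rel-Δ₀ : ∀ {n} {φ : Fm n} A → Δ₀ φ → rel A φ ≡ φ
rel-Δ₀ A (mem x y)  = refl
rel-Δ₀ A (eq x y)   = refl
rel-Δ₀ A bot        = refl
rel-Δ₀ A (and p q)  = cong₂ _∧'_ (rel-Δ₀ A p) (rel-Δ₀ A q)
rel-Δ₀ A (or p q)   = cong₂ _∨'_ (rel-Δ₀ A p) (rel-Δ₀ A q)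
rel-Δ₀ A (imp p q)  = cong₂ _⇒'_ (rel-Δ₀ A p) (rel-Δ₀ A q)
rel-Δ₀ A (ball v p) = cong (∀∈ v) (rel-Δ₀ (suc A) p)
rel-Δ₀ A (bex v p)  = cong (∃∈ v) (rel-Δ₀ (suc A) p)

Δ₀-rel : ∀ {n} A (φ : Fm n) → Δ₀ (rel A φ)
Δ₀-rel A (x ∈' y) = mem x y
Δ₀-rel A (x ≐ y)  = eq x y
Δ₀-rel A ⊥'       = bot
Δ₀-rel A (φ ∧' ψ) = and (Δ₀-rel A φ) (Δ₀-rel A ψ)
Δ₀-rel A (φ ∨' ψ) = or (Δ₀-rel A φ) (Δ₀-rel A ψ)
Δ₀-rel A (φ ⇒' ψ) = imp (Δ₀-rel A φ) (Δ₀-rel A ψ)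
Δ₀-rel A (∀' φ)   = ball A (Δ₀-rel (suc A) φ)
Δ₀-rel A (∃' φ)   = bex A (Δ₀-rel (suc A) φ)
Δ₀-rel A (∀∈ v φ) = ball v (Δ₀-rel (suc A) φ)
Δ₀-rel A (∃∈ v φ) = bex v (Δ₀-rel (suc A) φ)

Δ₀-ren : ∀ {n m} (ρ : Fin n → Fin m) {φ} → Δ₀ φ → Δ₀ (ren ρ φ)
Δ₀-ren ρ (mem x y)  = mem _ _
Δ₀-ren ρ (eq x y)   = eq _ _
Δ₀-ren ρ bot        = bot
Δ₀-ren ρ (and p q)  = and (Δ₀-ren ρ p) (Δ₀-ren ρ q)
Δ₀-ren ρ (or p q)   = or (Δ₀-ren ρ p) (Δ₀-ren ρ q)
Δ₀-ren ρ (imp p q)  = imp (Δ₀-ren ρ p) (Δ₀-ren ρ q)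
Δ₀-ren ρ (ball v p) = ball _ (Δ₀-ren (ext ρ) p)
Δ₀-ren ρ (bex v p)  = bex _ (Δ₀-ren (ext ρ) p)

IsΠ-ren : ∀ {n m} (ρ : Fin n → Fin m) {φ} → IsΠ φ → IsΠ (ren ρ φ)
IsΠ-ren ρ (δ₀ p)     = δ₀ (Δ₀-ren ρ p)
IsΠ-ren ρ (and p q)  = and (IsΠ-ren ρ p) (IsΠ-ren ρ q)
IsΠ-ren ρ (or p q)   = or (IsΠ-ren ρ p) (IsΠ-ren ρ q)
IsΠ-ren ρ (ball v p) = ball _ (IsΠ-ren (ext ρ) p)
IsΠ-ren ρ (bex v p)  = bex _ (IsΠ-ren (ext ρ) p)
IsΠ-ren ρ (all p)    = all (IsΠ-ren (ext ρ) p)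

castD : ∀ {T : Theory} {n} {Γ : List (Fm n)} {φ ψ} → φ ≡ ψ → T ⨾ Γ ⊢ φ → T ⨾ Γ ⊢ ψ
castD refl d = d

_⊆ᶜ_ : ∀ {n} → List (Fm n) → List (Fm n) → Set
Γ ⊆ᶜ Δ = ∀ {ψ} → ψ ∈ Γ → ψ ∈ Δ

⊆ᶜ-wk : ∀ {n} {Γ Δ : List (Fm n)} → Γ ⊆ᶜ Δ → map wk Γ ⊆ᶜ map wk Δ
⊆ᶜ-wk {Γ = Γ} s p with ∈-map⁻ wk {xs = Γ} p
... | χ , q , refl = ∈-map⁺ wk (s q)

⊆ᶜ-cons : ∀ {n} {Γ Δ : List (Fm n)} {φ} → Γ ⊆ᶜ Δ → (φ ∷ Γ) ⊆ᶜ (φ ∷ Δ)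
⊆ᶜ-cons s (here px) = here px
⊆ᶜ-cons s (there p) = there (s p)

weakenCtx : ∀ {T : Theory} {n} {Γ Δ : List (Fm n)} {φ} → Γ ⊆ᶜ Δ → T ⨾ Γ ⊢ φ → T ⨾ Δ ⊢ φ
weakenCtx s (hyp p)        = hyp (s p)
weakenCtx s (ax t)         = ax t
weakenCtx s (⊥E d)         = ⊥E (weakenCtx s d)
weakenCtx s (∧I d e)       = ∧I (weakenCtx s d) (weakenCtx s e)
weakenCtx s (∧E₁ d)        = ∧E₁ (weakenCtx s d)
weakenCtx s (∧E₂ d)        = ∧E₂ (weakenCtx s d)
weakenCtx s (∨I₁ d)        = ∨I₁ (weakenCtx s d)
weakenCtx s (∨I₂ d)        = ∨I₂ (weakenCtx s d)
weakenCtx s (∨E d e f)     = ∨E (weakenCtx s d) (weakenCtx (⊆ᶜ-cons s) e) (weakenCtx (⊆ᶜ-cons s) f)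
weakenCtx s (⇒I d)         = ⇒I (weakenCtx (⊆ᶜ-cons s) d)
weakenCtx s (⇒E d e)       = ⇒E (weakenCtx s d) (weakenCtx s e)
weakenCtx s (∀I d)         = ∀I (weakenCtx (⊆ᶜ-wk s) d)
weakenCtx s (∀E d t)       = ∀E (weakenCtx s d) t
weakenCtx s (∃I t d)       = ∃I t (weakenCtx s d)
weakenCtx s (∃E d e)       = ∃E (weakenCtx s d) (weakenCtx (⊆ᶜ-cons (⊆ᶜ-wk s)) e)
weakenCtx s (∀∈I d)        = ∀∈I (weakenCtx (⊆ᶜ-cons (⊆ᶜ-wk s)) d)
weakenCtx s (∀∈E d t e)    = ∀∈E (weakenCtx s d) t (weakenCtx s e)
weakenCtx s (∃∈I t e d)    = ∃∈I t (weakenCtx s e) (weakenCtx s d)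
weakenCtx s (∃∈E d e)      = ∃∈E (weakenCtx s d) (weakenCtx (⊆ᶜ-cons (⊆ᶜ-cons (⊆ᶜ-wk s))) e)
weakenCtx s (≐refl t)      = ≐refl t
weakenCtx s (≐subst φ e d) = ≐subst φ (weakenCtx s e) (weakenCtx s d)

RenClosed : Theory → Set
RenClosed T = ∀ {n m} (ρ : Fin n → Fin m) {φ : Fm n} → T φ → T (ren ρ φ)

_⊆ᶜ[_]_ : ∀ {n m} → List (Fm n) → (Fin n → Fin m) → List (Fm m) → Set
Γ ⊆ᶜ[ ρ ] Δ = ∀ {ψ} → ψ ∈ Γ → ren ρ ψ ∈ Δ

⊆ᶜ[]-cons : ∀ {n m} {ρ : Fin n → Fin m} {Γ Δ} {φ} → Γ ⊆ᶜ[ ρ ] Δ → (φ ∷ Γ) ⊆ᶜ[ ρ ] (ren ρ φ ∷ Δ)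
⊆ᶜ[]-cons s (here refl) = here refl
⊆ᶜ[]-cons s (there p)   = there (s p)

⊆ᶜ[]-wk : ∀ {n m} {ρ : Fin n → Fin m} {Γ Δ} → Γ ⊆ᶜ[ ρ ] Δ → map wk Γ ⊆ᶜ[ ext ρ ] map wk Δ
⊆ᶜ[]-wk {ρ = ρ} {Γ = Γ} s p with ∈-map⁻ wk {xs = Γ} p
... | χ , q , refl = subst (_∈ _) (sym (wk-ren ρ χ)) (∈-map⁺ wk (s q))

renameD : ∀ {T : Theory} → RenClosed T → ∀ {n m} {Γ : List (Fm n)} {Δ : List (Fm m)}
          (ρ : Fin n → Fin m) → Γ ⊆ᶜ[ ρ ] Δ → ∀ {φ} → T ⨾ Γ ⊢ φ → T ⨾ Δ ⊢ ren ρ φ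
renameD cl ρ s (hyp p)   = hyp (s p)
renameD cl ρ s (ax t)    = ax (cl ρ t)
renameD cl ρ s (⊥E d)    = ⊥E (renameD cl ρ s d)
renameD cl ρ s (∧I d e)  = ∧I (renameD cl ρ s d) (renameD cl ρ s e)
renameD cl ρ s (∧E₁ d)   = ∧E₁ (renameD cl ρ s d)
renameD cl ρ s (∧E₂ d)   = ∧E₂ (renameD cl ρ s d)
renameD cl ρ s (∨I₁ d)   = ∨I₁ (renameD cl ρ s d)
renameD cl ρ s (∨I₂ d)   = ∨I₂ (renameD cl ρ s d)
renameD cl ρ s (∨E d e f) =
  ∨E (renameD cl ρ s d) (renameD cl ρ (⊆ᶜ[]-cons s) e) (renameD cl ρ (⊆ᶜ[]-cons s) f)
renameD cl ρ s (⇒I d)    = ⇒I (renameD cl ρ (⊆ᶜ[]-cons s) d)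
renameD cl ρ s (⇒E d e)  = ⇒E (renameD cl ρ s d) (renameD cl ρ s e)
renameD cl ρ s (∀I d)    = ∀I (renameD cl (ext ρ) (⊆ᶜ[]-wk s) d)
renameD cl ρ s (∀E {φ = φ} d t) = castD (sym (inst-ren ρ t φ)) (∀E (renameD cl ρ s d) (ρ t))
renameD cl ρ s (∃I {φ = φ} t d) = ∃I (ρ t) (castD (inst-ren ρ t φ) (renameD cl ρ s d))
renameD cl ρ s (∃E {ψ = ψ} d e) =
  ∃E (renameD cl ρ s d) (castD (wk-ren ρ ψ) (renameD cl (ext ρ) (⊆ᶜ[]-cons (⊆ᶜ[]-wk s)) e))
renameD cl ρ s (∀∈I d)   = ∀∈I (renameD cl (ext ρ) (⊆ᶜ[]-cons (⊆ᶜ[]-wk s)) d)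
renameD cl ρ s (∀∈E {φ = φ} d t e) =
  castD (sym (inst-ren ρ t φ)) (∀∈E (renameD cl ρ s d) (ρ t) (renameD cl ρ s e))
renameD cl ρ s (∃∈I {φ = φ} t e d) =
  ∃∈I (ρ t) (renameD cl ρ s e) (castD (inst-ren ρ t φ) (renameD cl ρ s d))
renameD cl ρ s (∃∈E {ψ = ψ} d e) = ∃∈E (renameD cl ρ s d)
  (castD (wk-ren ρ ψ) (renameD cl (ext ρ) (⊆ᶜ[]-cons (⊆ᶜ[]-cons (⊆ᶜ[]-wk s))) e))
renameD cl ρ s (≐refl t) = ≐refl (ρ t)
renameD cl ρ s (≐subst {s = a} {t = b} φ e d) =
  castD (sym (inst-ren ρ b φ))
        (≐subst (ren (ext ρ) φ) (renameD cl ρ s e) (castD (inst-ren ρ a φ) (renameD cl ρ s d)))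

cutAxioms : ∀ {T T' : Theory} → T' ⊩ T → ∀ {n} {Γ : List (Fm n)} {φ} → T ⨾ Γ ⊢ φ → T' ⨾ Γ ⊢ φ
cutAxioms f (hyp p)        = hyp p
cutAxioms f (ax t)         = weakenCtx (λ ()) (f t)
cutAxioms f (⊥E d)         = ⊥E (cutAxioms f d)
cutAxioms f (∧I d e)       = ∧I (cutAxioms f d) (cutAxioms f e)
cutAxioms f (∧E₁ d)        = ∧E₁ (cutAxioms f d)
cutAxioms f (∧E₂ d)        = ∧E₂ (cutAxioms f d)
cutAxioms f (∨I₁ d)        = ∨I₁ (cutAxioms f d)
cutAxioms f (∨I₂ d)        = ∨I₂ (cutAxioms f d)
cutAxioms f (∨E d e g)     = ∨E (cutAxioms f d) (cutAxioms f e) (cutAxioms f g)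
cutAxioms f (⇒I d)         = ⇒I (cutAxioms f d)
cutAxioms f (⇒E d e)       = ⇒E (cutAxioms f d) (cutAxioms f e)
cutAxioms f (∀I d)         = ∀I (cutAxioms f d)
cutAxioms f (∀E d t)       = ∀E (cutAxioms f d) t
cutAxioms f (∃I t d)       = ∃I t (cutAxioms f d)
cutAxioms f (∃E d e)       = ∃E (cutAxioms f d) (cutAxioms f e)
cutAxioms f (∀∈I d)        = ∀∈I (cutAxioms f d)
cutAxioms f (∀∈E d t e)    = ∀∈E (cutAxioms f d) t (cutAxioms f e)
cutAxioms f (∃∈I t e d)    = ∃∈I t (cutAxioms f e) (cutAxioms f d)
cutAxioms f (∃∈E d e)      = ∃∈E (cutAxioms f d) (cutAxioms f e)
cutAxioms f (≐refl t)      = ≐refl t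
cutAxioms f (≐subst φ e d) = ≐subst φ (cutAxioms f e) (cutAxioms f d)

chain : ∀ {S₁ S₂ S₃ : Theory} → (IKP⁻ ∪ₜ S₁) ⊩ S₂ → (IKP⁻ ∪ₜ S₂) ⊩ S₃ → (IKP⁻ ∪ₜ S₁) ⊩ S₃
chain h₁₂ h₂₃ s = cutAxioms (λ { (inj₁ i) → ax (inj₁ i) ; (inj₂ t) → h₁₂ t }) (h₂₃ s)

IKP⁻-ren : RenClosed IKP⁻
IKP⁻-ren ρ emptySet       = emptySet
IKP⁻-ren ρ pairing        = pairing
IKP⁻-ren ρ union          = union
IKP⁻-ren ρ extensionality = extensionality
IKP⁻-ren ρ infinity       = infinity
IKP⁻-ren ρ (∈-induction φ) = subst IKP⁻ eqn (∈-induction (ren (ext ρ) φ))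
  where
  eqn : ∈-IndInst (ren (ext ρ) φ) ≡ ren ρ (∈-IndInst φ)
  eqn = cong (λ X → ∀' (∀∈ v0 X ⇒' ren (ext ρ) φ) ⇒' ∀' (ren (ext ρ) φ))
             (trans (ren-fuse (ext suc) (ext ρ) _ (λ { zero → refl ; (suc i) → refl }) φ)
                    (sym (ren-comp (ext (ext ρ)) (ext suc) φ)))
IKP⁻-ren ρ (Δ₀-separation φ p) =
  subst IKP⁻ eqn (Δ₀-separation (ren (ext ρ) φ) (Δ₀-ren (ext ρ) p))
  where
  eqn : SepInst (ren (ext ρ) φ) ≡ ren ρ (SepInst φ)
  eqn = cong (λ X → ∀' (∃' (∀' ((v0 ∈' v1) ⇔' ((v0 ∈' v2) ∧' X)))))
             (trans (ren-fuse (ext (λ i → suc (suc i))) (ext ρ) _ (λ { zero → refl ; (suc i) → refl }) φ)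
                    (sym (ren-comp (ext (ext (ext ρ))) (ext (λ i → suc (suc i))) φ)))

ΠPersistence-ren : RenClosed ΠPersistence
ΠPersistence-ren ρ (inst φ p) =
  subst ΠPersistence (cong (_⇒' ren ρ φ) (sym (everyRel-ren ρ φ))) (inst (ren ρ φ) (IsΠ-ren ρ p))

UnifInst-ren : ∀ {n m} (ρ : Fin n → Fin m) A φ →
               UnifInst (ρ A) (ren (ext (ext ρ)) φ) ≡ ren ρ (UnifInst A φ)
UnifInst-ren ρ A φ =
  cong (λ X → ∀' (∃∈ (suc (ρ A)) (∀∈ v1 X)) ⇒' ∃∈ (ρ A) (∀' (ren (ext (ext ρ)) φ)))
       (trans (ren-fuse (ext (ext suc)) (ext (ext ρ)) _
                        (λ { zero → refl ; (suc zero) → refl ; (suc (suc i)) → refl }) φ)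
              (sym (ren-comp (ext (ext (ext ρ))) (ext (ext suc)) φ)))

Δ₀Uniformity-ren : RenClosed Δ₀Uniformity
Δ₀Uniformity-ren ρ (inst A φ p) =
  subst Δ₀Uniformity (UnifInst-ren ρ A φ) (inst (ρ A) _ (Δ₀-ren (ext (ext ρ)) p))

∪ₜ-ren : ∀ {T S : Theory} → RenClosed T → RenClosed S → RenClosed (T ∪ₜ S)
∪ₜ-ren a b ρ (inj₁ t) = inj₁ (a ρ t)
∪ₜ-ren a b ρ (inj₂ t) = inj₂ (b ρ t)

-- x is inhabited (the Δ₀ counterpart of isEmpty)
inh : ∀ {n} → Fin n → Fm n
inh x = ∃∈ x (⊥' ⇒' ⊥')

module Derived (T : Theory) (T-ren : RenClosed T) (ikp : ∀ {n} {φ : Fm n} → IKP⁻ φ → T φ) where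

  infix 2 _⊢_
  _⊢_ : ∀ {n} → List (Fm n) → Fm n → Set
  Γ ⊢ φ = T ⨾ Γ ⊢ φ

  h0 : ∀ {n} {Γ : List (Fm n)} {φ} → (φ ∷ Γ) ⊢ φ
  h0 = hyp (here refl)

  h1 : ∀ {n} {Γ : List (Fm n)} {φ ψ} → (ψ ∷ φ ∷ Γ) ⊢ φ
  h1 = hyp (there (here refl))

  h2 : ∀ {n} {Γ : List (Fm n)} {φ ψ χ} → (χ ∷ ψ ∷ φ ∷ Γ) ⊢ φ
  h2 = hyp (there (there (here refl)))

  h3 : ∀ {n} {Γ : List (Fm n)} {φ ψ χ ω} → (ω ∷ χ ∷ ψ ∷ φ ∷ Γ) ⊢ φ
  h3 = hyp (there (there (there (here refl))))

  wk0 : ∀ {n} {Γ : List (Fm n)} {φ} → Γ ⊢ φ → map wk Γ ⊢ wk φ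
  wk0 d = renameD T-ren suc (∈-map⁺ wk) d

  wk1 : ∀ {n} {Γ : List (Fm n)} {φ ψ} → Γ ⊢ φ → (ψ ∷ map wk Γ) ⊢ wk φ
  wk1 d = weakenCtx there (wk0 d)

  wk2 : ∀ {n} {Γ : List (Fm n)} {φ ψ ψ'} → Γ ⊢ φ → (ψ ∷ ψ' ∷ map wk Γ) ⊢ wk φ
  wk2 d = weakenCtx (there ∘ there) (wk0 d)

  thin : ∀ {n} {Γ : List (Fm n)} {φ ψ} → Γ ⊢ φ → (ψ ∷ Γ) ⊢ φ
  thin d = weakenCtx there d

  ∀-map : ∀ {n} {Γ : List (Fm n)} {α β} →
          (map wk Γ ⊢ α → map wk Γ ⊢ β) → Γ ⊢ ∀' α → Γ ⊢ ∀' β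
  ∀-map {α = α} f d = ∀I (f (castD (inst-v0 α) (∀E (wk0 d) v0)))

  ∀∈-map : ∀ {n} {Γ : List (Fm n)} {v α β} →
           ((v0 ∈' suc v) ∷ map wk Γ ⊢ α → (v0 ∈' suc v) ∷ map wk Γ ⊢ β) → Γ ⊢ ∀∈ v α → Γ ⊢ ∀∈ v β
  ∀∈-map {α = α} f d = ∀∈I (f (castD (inst-v0 α) (∀∈E (wk1 d) v0 h0)))

  ∃∈-map : ∀ {n} {Γ : List (Fm n)} {v α β} →
           (α ∷ (v0 ∈' suc v) ∷ map wk Γ ⊢ α → α ∷ (v0 ∈' suc v) ∷ map wk Γ ⊢ β) →
           Γ ⊢ ∃∈ v α → Γ ⊢ ∃∈ v β
  ∃∈-map {β = β} f d = ∃∈E d (∃∈I v0 h1 (castD (sym (inst-v0 β)) (f h0)))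

  -- ∀x φ → φ for x not free in φ: the universe is inhabited (Empty Set).
  ∀-vacuous : ∀ {n} {Γ : List (Fm n)} {φ} → Γ ⊢ ∀' (wk φ) → Γ ⊢ φ
  ∀-vacuous {φ = φ} d = ∃E (ax (ikp emptySet)) (castD (inst-v0 (wk φ)) (∀E (wk1 d) v0))

  union-of : ∀ {n} {Γ : List (Fm n)} (b : Fin n) → Γ ⊢ ∃' (∀∈ (suc b) (∀∈ v0 (v0 ∈' v2)))
  union-of b = ∀E (ax (ikp union)) b

  pair-of : ∀ {n} {Γ : List (Fm n)} (a b : Fin n) → Γ ⊢ ∃' ((suc a ∈' v0) ∧' (suc b ∈' v0))
  pair-of a b = ∀E (∀E (ax (ikp pairing)) a) b

  -- Some C has a ⊆ C and b ∈ C: take ⋃{a, {b}}.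
  cover : ∀ {n} {Γ : List (Fm n)} (a b : Fin n) → Γ ⊢ ∃' ((∀∈ (suc a) (v0 ∈' v1)) ∧' (suc b ∈' v0))
  cover a b =
    ∃E (pair-of b b) (∃E (pair-of (suc a) v0) (∃E (union-of v0)
      (∃I v0 (∧I (∀∈I (∀∈E (∀∈E h1 (suc (suc (suc (suc a)))) (∧E₁ h2)) v0 h0))
                 (∀∈E (∀∈E h0 v2 (∧E₂ h1)) (suc (suc (suc b))) (∧E₁ h2))))))

  -- Some set contains an empty and an inhabited member: 0 and 1 from Infinity.
  two : ∀ {n} {Γ : List (Fm n)} → Γ ⊢ ∃' (∃∈ v0 (isEmpty v0) ∧' ∃∈ v0 (inh v0))
  two = ∃E (ax (ikp infinity)) (∃I v0 (∧I (∧E₁ h0)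
          (∃∈E (∧E₁ h0) (∃∈E (∀∈E (∧E₁ (∧E₂ h2)) v0 h1)
             (∃∈I v0 h1 (∃∈I v1 (∧E₂ (∧E₂ h0)) (⇒I h0)))))))

  empty-disjoint-inh : ∀ {n} {Γ : List (Fm n)} (x : Fin n) → Γ ⊢ (isEmpty x ∧' inh x) ⇒' ⊥'
  empty-disjoint-inh x = ⇒I (∃∈E (∧E₂ h0) (∀∈E (∧E₁ h2) v0 h1))

  Π-down : ∀ {n} {χ : Fm n} → IsΠ χ → ∀ B {Γ} → Γ ⊢ χ → Γ ⊢ rel B χ
  Π-down (δ₀ p)     B d = castD (sym (rel-Δ₀ B p)) d
  Π-down (and p q)  B d = ∧I (Π-down p B (∧E₁ d)) (Π-down q B (∧E₂ d))
  Π-down (or p q)   B d = ∨E d (∨I₁ (Π-down p B h0)) (∨I₂ (Π-down q B h0))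
  Π-down (ball v p) B d = ∀∈-map (Π-down p (suc B)) d
  Π-down (bex v p)  B d = ∃∈-map (Π-down p (suc B)) d
  Π-down {χ = ∀' χ} (all p) B d = ∀∈I (Π-down p (suc B) (castD (inst-v0 χ) (∀E (wk1 d) v0)))

  rel-antitone : ∀ {n} {χ : Fm n} → IsΠ χ → ∀ C D {Γ} →
                 Γ ⊢ ∀∈ C (v0 ∈' suc D) → Γ ⊢ rel D χ → Γ ⊢ rel C χ
  rel-antitone (δ₀ p)     C D s d = castD (trans (rel-Δ₀ D p) (sym (rel-Δ₀ C p))) d
  rel-antitone (and p q)  C D s d = ∧I (rel-antitone p C D s (∧E₁ d)) (rel-antitone q C D s (∧E₂ d))
  rel-antitone (or p q)   C D s d =
    ∨E d (∨I₁ (rel-antitone p C D (thin s) h0)) (∨I₂ (rel-antitone q C D (thin s) h0))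
  rel-antitone (ball v p) C D s d = ∀∈-map (rel-antitone p (suc C) (suc D) (wk1 s)) d
  rel-antitone (bex v p)  C D s d = ∃∈-map (rel-antitone p (suc C) (suc D) (wk2 s)) d
  rel-antitone {χ = ∀' χ} (all p) C D s d =
    ∀∈I (rel-antitone p (suc C) (suc D) (wk1 s)
      (castD (inst-v0 (rel (suc D) χ)) (∀∈E (wk1 d) v0 (∀∈E (wk1 s) v0 h0))))

  rel-members : ∀ {n} {χ : Fm n} → IsΠ χ → ∀ U B {Γ} →
                Γ ⊢ ∀∈ B (∀∈ v0 (v0 ∈' suc (suc U))) → Γ ⊢ rel U χ → Γ ⊢ ∀∈ B (rel v0 (wk χ))
  rel-members {χ = χ} p U B s d =
    ∀∈I (rel-antitone (IsΠ-ren suc p) v0 (suc U) (∀∈E (wk1 s) v0 h0) (castD (rel-ren suc U χ) (wk1 d)))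


  -- If one of two disjoint alternatives ε, ι holds at every point, together
  -- with α resp. β, then one of them holds throughout (test it at some t).
  split-∀ : ∀ {n} {Γ : List (Fm n)} {ε ι : Fm n} {α β : Fm (suc n)} →
            Γ ⊢ (ε ∧' ι) ⇒' ⊥' → (t : Fin n) →
            Γ ⊢ ∀' ((wk ε ∧' α) ∨' (wk ι ∧' β)) → Γ ⊢ ∀' α ∨' ∀' β
  split-∀ {ε = ε} {ι} {α} {β} disjoint t d =
    ∨E (castD instance-at-t (∀E d t))
       (∨I₁ (∀-map (λ e → ∨E e (∧E₂ h0) (⊥E (⇒E (wk2 disjoint) (∧I (∧E₁ h1) (∧E₁ h0))))) (thin d)))
       (∨I₂ (∀-map (λ e → ∨E e (⊥E (⇒E (wk2 disjoint) (∧I (∧E₁ h0) (∧E₁ h1)))) (∧E₂ h0)) (thin d)))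
    where
    instance-at-t : ((wk ε ∧' α) ∨' (wk ι ∧' β)) [ t ] ≡ (ε ∧' α [ t ]) ∨' (ι ∧' β [ t ])
    instance-at-t = cong₂ (λ a b → (a ∧' α [ t ]) ∨' (b ∧' β [ t ])) (wk-inst ε t) (wk-inst ι t)

  module FromPersistence (persistence : ∀ {n} {χ : Fm n} → IsΠ χ → T (everyRel χ ⇒' χ)) where

    -- The uniformity premise gives (∃x∈A ∀y φ)^(B) for all B, by downward
    -- absoluteness of φ; persistence for ∃x∈A ∀y φ concludes.
    Π-uniformity : ∀ {n} (A : Fin n) (φ : Fm (suc (suc n))) → IsΠ φ → [] ⊢ UnifInst A φ
    Π-uniformity A φ p =
      ⇒I (⇒E (ax (persistence (bex A (all p))))
             (∀-map (∃∈-map (∀∈-map (Π-down (IsΠ-ren (ext (ext suc)) p) v2))) h0))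

  module FromΔ₀Uniformity
    (uniformity : ∀ {n} (A : Fin n) (φ : Fm (suc (suc n))) → Δ₀ φ → T (UnifInst A φ)) where

    -- Base case: a Δ₀ formula is its own relativisation.
    everyRel-Δ₀ : ∀ {n} {Γ : List (Fm n)} {χ} → Δ₀ χ → Γ ⊢ everyRel χ → Γ ⊢ χ
    everyRel-Δ₀ p d = ∀-vacuous (castD (cong ∀' (rel-Δ₀ v0 (Δ₀-ren suc p))) d)

    everyRel-∀∈ : ∀ {n} {Γ : List (Fm n)} {v χ} → Γ ⊢ everyRel (∀∈ v χ) → Γ ⊢ ∀∈ v (everyRel χ)
    everyRel-∀∈ {χ = χ} d = ∀∈I (∀I (castD swapped (∀∈E (∀E (wk0 (wk1 d)) v0) v1 h0)))
      where
      swapped : (ren (ext (sub₁ v0)) (ren (ext (ext suc)) (ren (ext (ext suc)) (rel v1 (ren (ext suc) χ)))))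
                  [ v1 ] ≡ rel v0 (wk χ)
      swapped = trans (rel-ren-push (rel-ren-push (rel-ren-push (rel-ren-push refl))))
                      (rel-ren-cong χ (λ { zero → refl ; (suc i) → refl }))

    -- ∀A ∀u∈A χ^(A)(u)  ⊢  ∀u ∀A χ^(A)(u): pass to some C ⊇ A with u ∈ C.
    everyRel-∀ : ∀ {n} {Γ : List (Fm n)} {χ} → IsΠ χ → Γ ⊢ everyRel (∀' χ) → Γ ⊢ ∀' (everyRel χ)
    everyRel-∀ {χ = χ} p d =
      ∀I (∀I (∃E (cover v0 v1)
        (castD (sym (rel-ren-push refl))
          (rel-antitone (IsΠ-ren (λ i → suc (suc i)) p) v1 v0 (∧E₁ h0)
            (castD atC (∀∈E (∀E (thin (wk0 (wk0 (wk0 d)))) v0) v2 (∧E₂ h0)))))))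
      where
      atC : (ren (ext (sub₁ v0)) (ren (ext (ext suc)) (ren (ext (ext suc)) (ren (ext (ext suc))
              (rel v1 (ren (ext suc) χ)))))) [ v2 ] ≡ rel v0 (ren (λ i → suc (suc i)) χ)
      atC = trans (rel-ren-push (rel-ren-push (rel-ren-push (rel-ren-push (rel-ren-push refl)))))
                  (rel-ren-cong χ (λ { zero → refl ; (suc i) → refl }))

    -- ∀A ∃u∈v χ^(A)(u)  ⊢  ∃u∈v ∀A χ^(A)(u), by Δ₀ uniformity for
    -- φ(u, y) = χ^(y)(u): for each B, the instance at U ⊇ ⋃B serves all y ∈ B.
    everyRel-∃∈ : ∀ {n} {Γ : List (Fm n)} {v χ} → IsΠ χ → Γ ⊢ everyRel (∃∈ v χ) → Γ ⊢ ∃∈ v (everyRel χ)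
    everyRel-∃∈ {n} {v = v} {χ} p d =
      ⇒E (ax (uniformity v (rel v0 (wk χ)) (Δ₀-rel v0 (wk χ))))
         (∀I (∃E (union-of v0)
           (∃∈-map (λ e → castD (cong (∀∈ v2) forMembers) (rel-members (IsΠ-ren ρ p) v1 v2 h2 (castD atU e)))
                   (∀E (thin (wk0 (wk0 d))) v0))))
      where
      -- the scope is u, U, B followed by the parameters; ρ places χ in it
      ρ : Fin (suc n) → Fin (suc (suc (suc n)))
      ρ = λ { zero → v0 ; (suc i) → suc (suc (suc i)) }

      atU : ren (ext (sub₁ v0)) (ren (ext (ext suc)) (ren (ext (ext suc)) (rel (suc v0) (ren (ext suc) χ))))
            ≡ rel v1 (ren ρ χ)
      atU = trans (rel-ren-push (rel-ren-push (rel-ren-push refl)))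
                  (rel-ren-cong χ (λ { zero → refl ; (suc i) → refl }))

      forMembers : rel v0 (wk (ren ρ χ)) ≡ ren (ext (ext suc)) (ren (ext (ext suc)) (rel v0 (wk χ)))
      forMembers = trans (cong (rel v0) (ren-comp suc ρ χ))
                         (sym (trans (rel-ren-push (rel-ren-push refl))
                                     (rel-ren-cong χ (λ { zero → refl ; (suc i) → refl }))))

    -- choice χ ψ (y, x): "x is empty and χ^(y), or x is inhabited and ψ^(y)"
    choice : ∀ {n} → Fm n → Fm n → Fm (suc (suc n))
    choice χ ψ = (isEmpty v1 ∧' rel v0 (wk (wk χ))) ∨' (inh v1 ∧' rel v0 (wk (wk ψ)))

    choice-Δ₀ : ∀ {n} (χ ψ : Fm n) → Δ₀ (choice χ ψ)
    choice-Δ₀ χ ψ = or (and (ball v1 bot) (Δ₀-rel v0 _)) (and (bex v1 (imp bot bot)) (Δ₀-rel v0 _))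

    choice-ren : ∀ {n m} (ρ : Fin n → Fin m) χ ψ →
                 ren (ext (ext ρ)) (choice χ ψ) ≡ choice (ren ρ χ) (ren ρ ψ)
    choice-ren ρ χ ψ = cong₂ (λ a b → (isEmpty v1 ∧' a) ∨' (inh v1 ∧' b)) (rel-wk² χ) (rel-wk² ψ)
      where
      rel-wk² : ∀ χ → ren (ext (ext ρ)) (rel v0 (wk (wk χ))) ≡ rel v0 (wk (wk (ren ρ χ)))
      rel-wk² χ = trans (rel-ren (ext (ext ρ)) v0 (wk (wk χ)))
                        (cong (rel v0) (trans (wk-ren (ext ρ) (wk χ)) (cong wk (wk-ren ρ χ))))

    choice-at : ∀ {n} (x B : Fin n) χ ψ →
                (∀∈ (suc B) (choice χ ψ)) [ x ]
                ≡ ∀∈ B ((isEmpty (suc x) ∧' rel v0 (wk χ)) ∨' (inh (suc x) ∧' rel v0 (wk ψ)))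
    choice-at x B χ ψ =
      cong (∀∈ B) (cong₂ (λ a b → (isEmpty (suc x) ∧' a) ∨' (inh (suc x) ∧' b)) (rel-at χ) (rel-at ψ))
      where
      rel-at : ∀ χ → ren (ext (sub₁ x)) (rel v0 (wk (wk χ))) ≡ rel v0 (wk χ)
      rel-at χ = trans (rel-ren (ext (sub₁ x)) v0 (wk (wk χ)))
                       (cong (rel v0) (trans (ren-comp (ext (sub₁ x)) suc (wk χ))
                                             (ren-fuse _ suc suc (λ _ → refl) χ)))

    UniformChoice : ∀ {n} → Fin n → Fin n → Fm n → Fm n → Fm n
    UniformChoice t B χ ψ = ∃∈ t (∀∈ (suc B) (choice χ ψ))

    UniformChoice-ren : ∀ {n m} (ρ : Fin n → Fin m) t B χ ψ →
                        ren ρ (UniformChoice t B χ ψ) ≡ UniformChoice (ρ t) (ρ B) (ren ρ χ) (ren ρ ψ)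
    UniformChoice-ren ρ t B χ ψ = cong (∃∈ (ρ t) ∘ ∀∈ (suc (ρ B))) (choice-ren ρ χ ψ)

    UniformChoice-wk² : ∀ {n} (t B : Fin n) χ ψ →
                        wk (wk (UniformChoice t B χ ψ))
                        ≡ UniformChoice (suc (suc t)) (suc (suc B)) (wk (wk χ)) (wk (wk ψ))
    UniformChoice-wk² t B χ ψ =
      trans (cong wk (UniformChoice-ren suc t B χ ψ)) (UniformChoice-ren suc (suc t) (suc B) (wk χ) (wk ψ))

    choose-empty : ∀ {n} {Γ : List (Fm n)} {χ ψ} (x t B : Fin n) → Γ ⊢ x ∈' t → Γ ⊢ isEmpty x →
                   Γ ⊢ ∀∈ B (rel v0 (wk χ)) → Γ ⊢ UniformChoice t B χ ψ
    choose-empty {χ = χ} {ψ} x t B x∈t empty d =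
      ∃∈I x x∈t (castD (sym (choice-at x B χ ψ)) (∀∈-map (λ e → ∨I₁ (∧I (wk1 empty) e)) d))

    choose-inhabited : ∀ {n} {Γ : List (Fm n)} {χ ψ} (x t B : Fin n) → Γ ⊢ x ∈' t → Γ ⊢ inh x →
                       Γ ⊢ ∀∈ B (rel v0 (wk ψ)) → Γ ⊢ UniformChoice t B χ ψ
    choose-inhabited {χ = χ} {ψ} x t B x∈t inhabited d =
      ∃∈I x x∈t (castD (sym (choice-at x B χ ψ)) (∀∈-map (λ e → ∨I₂ (∧I (wk1 inhabited) e)) d))

    -- If t has an empty and an inhabited member and ∀A (χ^(A) ∨ ψ^(A)),
    -- then for each B a uniform choice exists: decide χ^(U) ∨ ψ^(U) at U ⊇ ⋃B.
    choose-uniformly : ∀ {n} {Γ : List (Fm n)} {χ ψ} → IsΠ χ → IsΠ ψ → ∀ t B →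
                       Γ ⊢ ∃∈ t (isEmpty v0) ∧' ∃∈ t (inh v0) → Γ ⊢ everyRel (χ ∨' ψ) →
                       Γ ⊢ UniformChoice t B χ ψ
    choose-uniformly {χ = χ} {ψ} p q t B zero-one d =
      ∃E (union-of B)
        (∨E (castD (inst-v0 _) (∀E (wk1 d) v0))
            (∃∈E (∧E₁ (wk2 zero-one)) (castD (sym (UniformChoice-wk² t B χ ψ))
              (choose-empty v0 _ _ h1 h0 (rel-members (Π-wk² p) v1 _ h3 (castD (rel-ren suc v0 (wk χ)) h2)))))
            (∃∈E (∧E₂ (wk2 zero-one)) (castD (sym (UniformChoice-wk² t B χ ψ))
              (choose-inhabited v0 _ _ h1 h0 (rel-members (Π-wk² q) v1 _ h3 (castD (rel-ren suc v0 (wk ψ)) h2))))))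
      where
      Π-wk² : ∀ {χ : Fm _} → IsΠ χ → IsΠ (wk (wk χ))
      Π-wk² p = IsΠ-ren suc (IsΠ-ren suc p)

    decide-choice : ∀ {n} {Γ : List (Fm n)} {χ ψ} (t : Fin n) →
                    Γ ⊢ ∃∈ t (∀' (choice χ ψ)) → Γ ⊢ everyRel χ ∨' everyRel ψ
    decide-choice {χ = χ} {ψ} t d =
      ∃∈E d (castD (sym (cong₂ _∨'_ (everyRel-ren suc χ) (everyRel-ren suc ψ)))
                   (split-∀ {ε = isEmpty v0} {ι = inh v0} (empty-disjoint-inh v0) v0 h0))

    -- ∀A (χ ∨ ψ)^(A)  ⊢  ∀A χ^(A) ∨ ∀A ψ^(A), by Δ₀ uniformity for choice χ ψ
    -- over a set containing 0 and 1.
    everyRel-∨ : ∀ {n} {Γ : List (Fm n)} {χ ψ} → IsΠ χ → IsΠ ψ →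
                 Γ ⊢ everyRel (χ ∨' ψ) → Γ ⊢ everyRel χ ∨' everyRel ψ
    everyRel-∨ {χ = χ} {ψ} p q d =
      ∃E two (castD (sym (cong₂ _∨'_ (everyRel-ren suc χ) (everyRel-ren suc ψ)))
        (decide-choice v0 (⇒E (ax (uniformity v0 (choice (wk χ) (wk ψ)) (choice-Δ₀ _ _)))
          (∀I (castD (sym (cong (∃∈ v1 ∘ ∀∈ v1) (choice-ren suc (wk χ) (wk ψ))))
                (choose-uniformly (IsΠ-ren suc (IsΠ-ren suc p)) (IsΠ-ren suc (IsΠ-ren suc q)) v1 v0 h0
                  (castD (trans (cong wk (everyRel-ren suc (χ ∨' ψ))) (everyRel-ren suc (wk (χ ∨' ψ))))
                         (wk0 (wk1 d)))))))))

    persistence : ∀ {n} {Γ : List (Fm n)} {χ} → IsΠ χ → Γ ⊢ everyRel χ → Γ ⊢ χ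
    persistence (δ₀ p)     d = everyRel-Δ₀ p d
    persistence (and p q)  d = ∧I (persistence p (∀-map ∧E₁ d)) (persistence q (∀-map ∧E₂ d))
    persistence (or p q)   d = ∨E (everyRel-∨ p q d) (∨I₁ (persistence p h0)) (∨I₂ (persistence q h0))
    persistence (ball v p) d = ∀∈-map (persistence p) (everyRel-∀∈ d)
    persistence (bex v p)  d = ∃∈-map (persistence p) (everyRel-∃∈ p d)
    persistence (all p)    d = ∀-map (persistence p) (everyRel-∀ p d)

persistence⇒Π-uniformity : (IKP⁻ ∪ₜ ΠPersistence) ⊩ ΠUniformity
persistence⇒Π-uniformity (inst A φ p) = FromPersistence.Π-uniformity (λ p → inj₂ (inst _ p)) A φ p
  where open Derived (IKP⁻ ∪ₜ ΠPersistence) (∪ₜ-ren IKP⁻-ren ΠPersistence-ren) inj₁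

Δ₀-uniformity⇒persistence : (IKP⁻ ∪ₜ Δ₀Uniformity) ⊩ ΠPersistence
Δ₀-uniformity⇒persistence (inst φ p) = ⇒I (FromΔ₀Uniformity.persistence (λ A φ p → inj₂ (inst A φ p)) p h0)
  where open Derived (IKP⁻ ∪ₜ Δ₀Uniformity) (∪ₜ-ren IKP⁻-ren Δ₀Uniformity-ren) inj₁

Π-uniformity⇒Δ₀-uniformity : (IKP⁻ ∪ₜ ΠUniformity) ⊩ Δ₀Uniformity
Π-uniformity⇒Δ₀-uniformity (inst A φ p) = ax (inj₂ (inst A φ (δ₀ p)))

mainTheorem1 : EquivOver IKP⁻ ΠPersistence ΠUniformity
             × EquivOver IKP⁻ ΠUniformity Δ₀Uniformity
             × EquivOver IKP⁻ ΠPersistence Δ₀Uniformity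
mainTheorem1 =
    (P⇒U , chain U⇒D D⇒P)
  , (U⇒D , chain D⇒P P⇒U)
  , (chain P⇒U U⇒D , D⇒P)
  where
  P⇒U : (IKP⁻ ∪ₜ ΠPersistence) ⊩ ΠUniformity
  P⇒U = persistence⇒Π-uniformity
  U⇒D : (IKP⁻ ∪ₜ ΠUniformity) ⊩ Δ₀Uniformity
  U⇒D = Π-uniformity⇒Δ₀-uniformity
  D⇒P : (IKP⁻ ∪ₜ Δ₀Uniformity) ⊩ ΠPersistence
  D⇒P = Δ₀-uniformity⇒persistence
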